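{- Let $G$ be a finite abelian multiplicative group and let $D=D_1\cup\dots\cup D_r$ (the $D_i$ distinct and pairwise disjoint, $1\notin D$) be a weighted partial difference set in $G$. Define $R_0=\{(x,x):x\in G\}$, $R_i=\{(x,y)\in G\times G: xy^{ -1}\in D_i,\ x\ne y\}$ for $1\le i\le r$, and $R_{r+1}=\{(x,y)\in G\times G: xy^{ -1}\notin D,\ x\neq y\}$. If $R_{r+1}$ is non-empty, then $(G,R_0,R_1,\dots,R_{r+1})$ is an association scheme of class $r+1$.
   Context: Weighted partial difference set: for all $1\le i,j,\ell\le r$ the list $D_iD_j^{ -1}=[d_1d_2^{ -1}:d_1\in D_i,d_2\in D_j]$ represents every non-identity element of $D_\ell$ exactly $\lambda_{i,j,\ell}$ times and every non-identity element of $G\setminus D$ exactly $\mu_{i,j}$ times (for some integers $\lambda_{i,j,\ell},\mu_{i,j}$), and for each $i$ there is $j$ with $D_i^{ -1}=D_j$. An $s$-class association scheme on a finite set $S$ is a tuple $(S,R_0,\dots,R_s)$ of relations with $R_0$ the diagonal, $S\times S$ the disjoint union of the $R_i$, for each $i$ some $j$ with $R_i^*=R_j$ (where $R^*=\{(x,y):(y,x)\in R\}$), and such that for all $i,j,k$ the number $|\{z\in S:(x,z)\in R_i,(z,y)\in R_j\}|$ is the same for all $(x,y)\in R_k$. -}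

module Defs where

open import Data.Nat using (ℕ; zero; suc; _+_)
open import Data.Fin using (Fin; zero; suc; _≟_)
open import Data.Bool using (Bool; true; false; _∧_; not; if_then_else_)
open import Data.List using (allFin)
open import Data.Bool.ListAction using (any)
open import Data.Product using (∃; ∃₂; Σ; _×_; _,_)
open import Relation.Nullary using (¬_)
open import Relation.Nullary.Decidable using (⌊_⌋)
open import Relation.Binary.PropositionalEquality using (_≡_; _≢_)
open import Function.Bundles using (_⇔_)
open import Algebra.Core using (Op₁; Op₂)
open import Algebra.Structures using (IsAbelianGroup)

count : ∀ {n} → (Fin n → Bool) → ℕ
count {zero} P = 0
count {suc n} P = (if P zero then 1 else 0) + count {n} (λ i → P (suc i))

sumFin : ∀ {n} → (Fin n → ℕ) → ℕ
sumFin {zero} f = 0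
sumFin {suc n} f = f zero + sumFin {n} (λ i → f (suc i))

count₂ : ∀ {n} → (Fin n → Fin n → Bool) → ℕ
count₂ P = sumFin (λ a → count (P a))

-- Association schemes on the finite set Fin n.
-- A relation on Fin n is represented by its (Boolean) characteristic
-- function; R k is the relation R_k, k = 0, …, s.

record IsAssociationScheme (n s : ℕ) (R : Fin (suc s) → Fin n → Fin n → Bool) : Set where
  field
    diagonal    : ∀ x y → (R zero x y ≡ true) ⇔ (x ≡ y)
    partition   : ∀ x y → ∃ λ k → R k x y ≡ true × (∀ k' → R k' x y ≡ true → k' ≡ k)
    transposes  : ∀ i → ∃ λ j → ∀ x y → R i y x ≡ R j x y
    intersection : ∀ i j k → ∃ λ p → ∀ x y → R k x y ≡ true →
                   count (λ z → R i x z ∧ R j z y) ≡ p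

-- Finite abelian groups: a finite group of order n is represented
-- (up to isomorphism) as an abelian group structure on Fin n with
-- propositional equality.

record FiniteAbelianGroup (n : ℕ) : Set where
  field
    _∙_   : Op₂ (Fin n)
    ε     : Fin n
    _⁻¹   : Op₁ (Fin n)
    isAbelianGroup : IsAbelianGroup _≡_ _∙_ ε _⁻¹

  infixl 7 _∙_
  infix 8 _⁻¹

  _==_ : Fin n → Fin n → Bool
  x == y = ⌊ x ≟ y ⌋

-- Weighted partial difference sets.  The family D_1, …, D_r of subsets
-- of G is given as D : Fin r → (Fin n → Bool); D = ⋃ D_i.

module _ {n : ℕ} (G : FiniteAbelianGroup n) where
  open FiniteAbelianGroup G

  inUnion : ∀ {r} → (Fin r → Fin n → Bool) → Fin n → Bool
  inUnion {r} D g = any (λ i → D i g) (allFin r)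

  -- number of times g occurs in the list D_i D_j^{-1}
  diffCount : (Fin n → Bool) → (Fin n → Bool) → Fin n → ℕ
  diffCount Di Dj g = count₂ (λ d₁ d₂ → Di d₁ ∧ Dj d₂ ∧ ((d₁ ∙ d₂ ⁻¹) == g))

  record IsWPDS (r : ℕ) (D : Fin r → Fin n → Bool) : Set where
    field
      lambda : ∀ i j ℓ → ∃ λ λᵢⱼₗ → ∀ g → D ℓ g ≡ true → g ≢ ε →
               diffCount (D i) (D j) g ≡ λᵢⱼₗ
      mu     : ∀ i j → ∃ λ μᵢⱼ → ∀ g → inUnion D g ≡ false → g ≢ ε →
               diffCount (D i) (D j) g ≡ μᵢⱼ
      inverse : ∀ i → ∃ λ j → ∀ g → D i (g ⁻¹) ≡ D j g

  lastCase : ∀ {r} {A : Set} → (Fin r → A) → A → Fin (suc r) → A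
  lastCase {zero}  f a zero    = a
  lastCase {suc r} f a zero    = f zero
  lastCase {suc r} f a (suc i) = lastCase (λ k → f (suc k)) a i

  relD : ∀ {r} → (Fin r → Fin n → Bool) → Fin r → Fin n → Fin n → Bool
  relD D i x y = D i (x ∙ y ⁻¹) ∧ not (x == y)

  relOut : ∀ {r} → (Fin r → Fin n → Bool) → Fin n → Fin n → Bool
  relOut D x y = not (inUnion D (x ∙ y ⁻¹)) ∧ not (x == y)

  schemeRel : ∀ {r} → (Fin r → Fin n → Bool) → Fin (suc (suc r)) → Fin n → Fin n → Bool
  schemeRel D zero    x y = x == y
  schemeRel D (suc k) = lastCase (relD D) (relOut D) k

-- Split G into the classes C₀ = {ε}, C_a = D_a (1 ≤ a ≤ r) and
-- C_out = G ∖ (D ∪ {ε}).  Then R_k = {(x , y) : x y⁻¹ ∈ C_k}, so the relations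
-- partition G × G because the classes partition G, and they are closed under
-- transposition because inversion permutes the classes.  The number of
-- z with (x , z) ∈ R_i and (z , y) ∈ R_j only depends on g = x y⁻¹; it is
--   N i j g = #{w ∈ C_i : g w⁻¹ ∈ C_j},
-- and it remains to show that N i j is constant on every class C_k.
--   * N 0 j g = [g ∈ C_j], and N a b g (a, b ≤ r) is a multiplicity in the
--     difference list D_a D_b⁻¹, constant on C_k by the WPDS axioms;
--   * N i j = N j i since G is abelian;
--   * ∑_j N i j g = |C_i|, so the single remaining column j = out is
--     constant too, and then the row i = out follows by symmetry.
module Submission where

open import Defs
open import Data.Nat using (ℕ; suc)
open import Data.Fin using (Fin)
open import Data.Bool using (Bool; true; false)
open import Data.Product using (∃₂)
open import Relation.Nullary using (¬_)
open import Relation.Binary.PropositionalEquality using (_≡_; _≢_)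

open import Data.Nat using (zero; _+_; _∸_)
open import Data.Nat.Properties using (+-0-commutativeMonoid; +-identityʳ; m+n∸n≡m)
open import Data.Fin using (zero; suc; _≟_; inject₁; fromℕ; punchIn)
open import Data.Fin.Properties using (punchInᵢ≢i)
open import Data.Fin.Permutation using (permutation)
import Data.Fin.Relation.Unary.Top as Top
open import Data.Bool using (_∧_; not; if_then_else_)
open import Data.Bool.Properties using (∧-comm; ∧-identityʳ; ∧-zeroʳ; T-≡; T-not-≡)
open import Data.Product using (∃; _×_; _,_; proj₁; proj₂)
open import Data.Empty using (⊥; ⊥-elim)
open import Data.List using (allFin)
open import Data.List.Membership.Propositional using (lose)
open import Data.List.Membership.Propositional.Properties using (∈-allFin)
open import Data.List.Relation.Unary.Any using (satisfied)
open import Data.List.Relation.Unary.Any.Properties using (any⁺; any⁻)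
open import Relation.Nullary using (yes; no; contradiction)
open import Relation.Nullary.Decidable
  using (⌊_⌋; toWitness; fromWitness; toWitnessFalse; fromWitnessFalse)
open import Relation.Binary.PropositionalEquality
  using (refl; sym; trans; cong; cong₂; module ≡-Reasoning)
open import Function.Bundles using (mk⇔; module Equivalence)
open import Algebra.Bundles using (AbelianGroup)
open import Algebra.Structures using (IsAbelianGroup)
import Algebra.Properties.AbelianGroup as AbelianGroupProperties
import Algebra.Properties.CommutativeSemigroup as CommutativeSemigroupProperties
import Algebra.Properties.CommutativeMonoid.Sum as Summation

open ≡-Reasoning

bool-ext : ∀ {b c : Bool} → (b ≡ true → c ≡ true) → (c ≡ true → b ≡ true) → b ≡ c
bool-ext {false} {false} _ _ = refl
bool-ext {false} {true}  _ c⇒b = c⇒b refl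
bool-ext {true}  {false} b⇒c _ = sym (b⇒c refl)
bool-ext {true}  {true}  _ _ = refl

∧-elimˡ : ∀ {b c} → b ∧ c ≡ true → b ≡ true
∧-elimˡ {true} _ = refl

∧-elimʳ : ∀ {b c} → b ∧ c ≡ true → c ≡ true
∧-elimʳ {true} bc = bc

not-true : ∀ {b} → not b ≡ true → b ≡ false
not-true {false} _ = refl

module _ {n : ℕ} where

  ==⇒≡ : ∀ {x y : Fin n} → ⌊ x ≟ y ⌋ ≡ true → x ≡ y
  ==⇒≡ eq = toWitness (Equivalence.from T-≡ eq)

  ≡⇒== : ∀ {x y : Fin n} → x ≡ y → ⌊ x ≟ y ⌋ ≡ true
  ≡⇒== x≡y = Equivalence.to T-≡ (fromWitness x≡y)

  ≢⇒==false : ∀ {x y : Fin n} → x ≢ y → ⌊ x ≟ y ⌋ ≡ false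
  ≢⇒==false x≢y = Equivalence.to T-not-≡ (fromWitnessFalse x≢y)

  not==⇒≢ : ∀ {x y : Fin n} → not ⌊ x ≟ y ⌋ ≡ true → x ≢ y
  not==⇒≢ eq = toWitnessFalse (Equivalence.from T-≡ eq)

  ==-cong : ∀ {x y u v : Fin n} → (x ≡ y → u ≡ v) → (u ≡ v → x ≡ y) →
            ⌊ x ≟ y ⌋ ≡ ⌊ u ≟ v ⌋
  ==-cong to from = bool-ext (λ e → ≡⇒== (to (==⇒≡ e))) (λ e → ≡⇒== (from (==⇒≡ e)))

-- Counting over Fin n: count and sumFin of Defs are expressed through the summation operator of
-- the commutative monoid (ℕ, +, 0), whose library lemmas (exchange of sums,
-- invariance under permutations, extraction of one term) then apply.

open Summation +-0-commutativeMonoid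
  using (sum; sum-cong-≗; sum-remove; sum-replicate-zero; ∑-comm; sum-permute)

ind : Bool → ℕ
ind b = if b then 1 else 0

sumFin≡sum : ∀ {n} (f : Fin n → ℕ) → sumFin f ≡ sum f
sumFin≡sum {zero}  f = refl
sumFin≡sum {suc n} f = cong (f zero +_) (sumFin≡sum (λ i → f (suc i)))

count≡sum : ∀ {n} (P : Fin n → Bool) → count P ≡ sum (λ w → ind (P w))
count≡sum {zero}  P = refl
count≡sum {suc n} P = cong (ind (P zero) +_) (count≡sum (λ i → P (suc i)))

sum-zero : ∀ {n} (f : Fin n → ℕ) → (∀ i → f i ≡ 0) → sum f ≡ 0
sum-zero {n} f f≡0 = trans (sum-cong-≗ f≡0) (sum-replicate-zero n)

sum-single : ∀ {n} (f : Fin n → ℕ) (c : Fin n) → (∀ i → i ≢ c → f i ≡ 0) → sum f ≡ f c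
sum-single {suc n} f c vanish = begin
  sum f                              ≡⟨ sum-remove {i = c} f ⟩
  f c + sum (λ j → f (punchIn c j))  ≡⟨ cong (f c +_) (sum-zero _ (λ j → vanish _ (punchInᵢ≢i c j))) ⟩
  f c + 0                            ≡⟨ +-identityʳ (f c) ⟩
  f c                                ∎

count-cong : ∀ {n} {P Q : Fin n → Bool} → (∀ w → P w ≡ Q w) → count P ≡ count Q
count-cong {P = P} {Q} P≗Q = begin
  count P                ≡⟨ count≡sum P ⟩
  sum (λ w → ind (P w))  ≡⟨ sum-cong-≗ (λ w → cong ind (P≗Q w)) ⟩
  sum (λ w → ind (Q w))  ≡⟨ count≡sum Q ⟨
  count Q                ∎

count-single : ∀ {n} (P : Fin n → Bool) (c : Fin n) → (∀ w → P w ≡ true → w ≡ c) →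
               count P ≡ ind (P c)
count-single P c only = trans (count≡sum P) (sum-single _ c vanish)
  where
  vanish : ∀ w → w ≢ c → ind (P w) ≡ 0
  vanish w w≢c with P w in Pw
  ... | true  = contradiction (only w Pw) w≢c
  ... | false = refl

count-involution : ∀ {n} (P : Fin n → Bool) (σ : Fin n → Fin n) → (∀ w → σ (σ w) ≡ w) →
                   count P ≡ count (λ w → P (σ w))
count-involution P σ σσ≡id = begin
  count P                    ≡⟨ count≡sum P ⟩
  sum (λ w → ind (P w))      ≡⟨ sum-permute _ (permutation σ σ σσ≡id σσ≡id) ⟩
  sum (λ w → ind (P (σ w)))  ≡⟨ count≡sum (λ w → P (σ w)) ⟨
  count (λ w → P (σ w))      ∎

ConstantOn : ∀ {n} → (Fin n → Bool) → (Fin n → ℕ) → Set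
ConstantOn S f = ∃ λ p → ∀ g → S g ≡ true → f g ≡ p

constant-remaining : ∀ {n m} (S : Fin n → Bool) (F : Fin (suc m) → Fin n → ℕ) (j₀ : Fin (suc m)) →
                     ConstantOn S (λ g → sum (λ j → F j g)) →
                     (∀ j → j ≢ j₀ → ConstantOn S (F j)) → ConstantOn S (F j₀)
constant-remaining S F j₀ (total , sum≡total) others = total ∸ rest , λ g g∈S → begin
  F j₀ g                                           ≡⟨ m+n∸n≡m (F j₀ g) rest ⟨
  F j₀ g + rest ∸ rest                             ≡⟨ cong (λ t → F j₀ g + t ∸ rest) (sum-cong-≗ (λ j → proj₂ (other j) g g∈S)) ⟨
  F j₀ g + sum (λ j → F (punchIn j₀ j) g) ∸ rest   ≡⟨ cong (_∸ rest) (sum-remove {i = j₀} (λ j → F j g)) ⟨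
  sum (λ j → F j g) ∸ rest                         ≡⟨ cong (_∸ rest) (sum≡total g g∈S) ⟩
  total ∸ rest                                     ∎
  where
  other : ∀ j → ConstantOn S (F (punchIn j₀ j))
  other j = others (punchIn j₀ j) (punchInᵢ≢i j₀ j)
  rest : ℕ
  rest = sum (λ j → proj₁ (other j))

module GroupFacts {n : ℕ} (G : FiniteAbelianGroup n) where
  open FiniteAbelianGroup G

  abelianGroup : AbelianGroup _ _
  abelianGroup = record { isAbelianGroup = isAbelianGroup }

  open AbelianGroupProperties abelianGroup
    using (⁻¹-anti-homo-//; xyx⁻¹≈y; x∙y⁻¹≈ε⇒x≈y; x≈y⇒x∙y⁻¹≈ε; ε⁻¹≈ε)
  open AbelianGroupProperties abelianGroup public using (⁻¹-involutive)
  open IsAbelianGroup isAbelianGroup using (assoc; identityʳ)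
  open CommutativeSemigroupProperties (AbelianGroup.commutativeSemigroup abelianGroup)
    using (xy∙z≈xz∙y)

  quotient-inverse : ∀ x y → (x ∙ y ⁻¹) ⁻¹ ≡ y ∙ x ⁻¹
  quotient-inverse = ⁻¹-anti-homo-//

  reflect-involutive : ∀ c w → c ∙ (c ∙ w ⁻¹) ⁻¹ ≡ w
  reflect-involutive c w = begin
    c ∙ (c ∙ w ⁻¹) ⁻¹  ≡⟨ cong (c ∙_) (quotient-inverse c w) ⟩
    c ∙ (w ∙ c ⁻¹)     ≡⟨ assoc c w (c ⁻¹) ⟨
    c ∙ w ∙ c ⁻¹       ≡⟨ xyx⁻¹≈y c w ⟩
    w                  ∎

  quotient-solve : ∀ x z g → x ∙ z ⁻¹ ≡ g → z ≡ x ∙ g ⁻¹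
  quotient-solve x z g xz⁻¹≡g = trans (sym (reflect-involutive x z)) (cong (λ t → x ∙ t ⁻¹) xz⁻¹≡g)

  quotient-swap : ∀ x w y → x ∙ w ⁻¹ ∙ y ⁻¹ ≡ x ∙ y ⁻¹ ∙ w ⁻¹
  quotient-swap x w y = xy∙z≈xz∙y x (w ⁻¹) (y ⁻¹)

  quotient-ε : ∀ x → x ∙ ε ⁻¹ ≡ x
  quotient-ε x = trans (cong (x ∙_) ε⁻¹≈ε) (identityʳ x)

  ==-quotient : ∀ x y → (x == y) ≡ ((x ∙ y ⁻¹) == ε)
  ==-quotient x y = ==-cong x≈y⇒x∙y⁻¹≈ε (x∙y⁻¹≈ε⇒x≈y x y)

  inverse-==ε : ∀ g → ((g ⁻¹) == ε) ≡ (g == ε)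
  inverse-==ε g = ==-cong (λ g⁻¹≡ε → trans (sym (⁻¹-involutive g)) (trans (cong _⁻¹ g⁻¹≡ε) ε⁻¹≈ε))
                          (λ g≡ε → trans (cong _⁻¹ g≡ε) ε⁻¹≈ε)

module _ {n : ℕ} (G : FiniteAbelianGroup n) where

  lastCase-inject₁ : ∀ {r} {A : Set} (f : Fin r → A) (a : A) (i : Fin r) →
                     lastCase G f a (inject₁ i) ≡ f i
  lastCase-inject₁ {suc r} f a zero    = refl
  lastCase-inject₁ {suc r} f a (suc i) = lastCase-inject₁ (λ k → f (suc k)) a i

  lastCase-fromℕ : ∀ {r} {A : Set} (f : Fin r → A) (a : A) → lastCase G f a (fromℕ r) ≡ a
  lastCase-fromℕ {zero}  f a = refl
  lastCase-fromℕ {suc r} f a = lastCase-fromℕ (λ k → f (suc k)) a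

out : ∀ {r} → Fin (suc (suc r))
out {r} = suc (fromℕ r)

data Kind {r : ℕ} : Fin (suc (suc r)) → Set where
  diagonal : Kind zero
  inner    : (a : Fin r) → Kind (suc (inject₁ a))
  outer    : Kind out

kind : ∀ {r} (k : Fin (suc (suc r))) → Kind k
kind zero = diagonal
kind (suc k) with Top.view k
... | Top.‵fromℕ     = outer
... | Top.‵inject₁ a = inner a

module Scheme {n r : ℕ} (G : FiniteAbelianGroup n) (D : Fin r → Fin n → Bool)
  (disjoint : ∀ i j → i ≢ j → ∀ g → D i g ≡ true → D j g ≡ false)
  (ε∉D : ∀ i → D i (FiniteAbelianGroup.ε G) ≡ false)
  (W : IsWPDS G r D) where

  open FiniteAbelianGroup G
  open GroupFacts G

  Index : Set
  Index = Fin (suc (suc r))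

  inD : Fin n → Bool
  inD = inUnion G D

  inD-intro : ∀ a g → D a g ≡ true → inD g ≡ true
  inD-intro a g g∈Da = Equivalence.to T-≡ (any⁺ _ (lose (∈-allFin a) (Equivalence.from T-≡ g∈Da)))

  inD-elim : ∀ g → inD g ≡ true → ∃ λ a → D a g ≡ true
  inD-elim g g∈D with satisfied (any⁻ _ (allFin r) (Equivalence.from T-≡ g∈D))
  ... | a , T[g∈Da] = a , Equivalence.to T-≡ T[g∈Da]

  -- D is closed under inversion, since every D_a⁻¹ is some D_b.
  inD-inverse : ∀ g → inD (g ⁻¹) ≡ inD g
  inD-inverse g = bool-ext (move g) (λ g∈D → move (g ⁻¹) (trans (cong inD (⁻¹-involutive g)) g∈D))
    where
    move : ∀ h → inD (h ⁻¹) ≡ true → inD h ≡ true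
    move h h⁻¹∈D with inD-elim _ h⁻¹∈D
    ... | a , h⁻¹∈Da with IsWPDS.inverse W a
    ...   | b , Da⁻¹≡Db = inD-intro b h (trans (sym (Da⁻¹≡Db h)) h⁻¹∈Da)

  outside : Fin n → Bool
  outside g = not (inD g) ∧ not (g == ε)

  C : Index → Fin n → Bool
  C zero    g = g == ε
  C (suc k) g = lastCase G (λ a → D a g) (outside g) k

  C-inner : ∀ a g → C (suc (inject₁ a)) g ≡ D a g
  C-inner a g = lastCase-inject₁ G (λ a → D a g) (outside g) a

  C-outer : ∀ g → C out g ≡ outside g
  C-outer g = lastCase-fromℕ G (λ a → D a g) (outside g)

  D⇒≢ε : ∀ a g → D a g ≡ true → g ≢ ε
  D⇒≢ε a g g∈Da refl = contradiction (trans (sym g∈Da) (ε∉D a)) λ ()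

  rel≡class : ∀ k x y → schemeRel G D k x y ≡ C k (x ∙ y ⁻¹)
  rel≡class k x y with kind k
  ... | diagonal = ==-quotient x y
  ... | inner a  = begin
    lastCase G (relD G D) (relOut G D) (inject₁ a) x y  ≡⟨ cong (λ R → R x y) (lastCase-inject₁ G (relD G D) (relOut G D) a) ⟩
    D a (x ∙ y ⁻¹) ∧ not (x == y)                       ≡⟨ cong (λ b → D a (x ∙ y ⁻¹) ∧ not b) (==-quotient x y) ⟩
    D a (x ∙ y ⁻¹) ∧ not ((x ∙ y ⁻¹) == ε)              ≡⟨ drop-≢ε (x ∙ y ⁻¹) ⟩
    D a (x ∙ y ⁻¹)                                      ≡⟨ C-inner a (x ∙ y ⁻¹) ⟨
    C (suc (inject₁ a)) (x ∙ y ⁻¹)                      ∎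
    where
    drop-≢ε : ∀ g → D a g ∧ not (g == ε) ≡ D a g
    drop-≢ε g with g ≟ ε
    ... | yes refl = trans (∧-zeroʳ (D a ε)) (sym (ε∉D a))
    ... | no _     = ∧-identityʳ (D a g)
  ... | outer = begin
    lastCase G (relD G D) (relOut G D) (fromℕ r) x y  ≡⟨ cong (λ R → R x y) (lastCase-fromℕ G (relD G D) (relOut G D)) ⟩
    not (inD (x ∙ y ⁻¹)) ∧ not (x == y)               ≡⟨ cong (λ b → not (inD (x ∙ y ⁻¹)) ∧ not b) (==-quotient x y) ⟩
    outside (x ∙ y ⁻¹)                                ≡⟨ C-outer (x ∙ y ⁻¹) ⟨
    C out (x ∙ y ⁻¹)                                  ∎

  outer⇒≢ε : ∀ {g} → C out g ≡ true → g ≢ ε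
  outer⇒≢ε {g} g∈out = not==⇒≢ (∧-elimʳ (trans (sym (C-outer g)) g∈out))

  outer⇒∉D : ∀ {g} → C out g ≡ true → inD g ≡ false
  outer⇒∉D {g} g∈out = not-true (∧-elimˡ (trans (sym (C-outer g)) g∈out))

  inner-outer : ∀ a {g} → C (suc (inject₁ a)) g ≡ true → C out g ≡ true → ⊥
  inner-outer a {g} g∈Da g∈out =
    contradiction (trans (sym (inD-intro a g (trans (sym (C-inner a g)) g∈Da))) (outer⇒∉D g∈out)) λ ()

  class-unique : ∀ {g} k k′ → C k g ≡ true → C k′ g ≡ true → k ≡ k′
  class-unique {g} k k′ g∈k g∈k′ with kind k | kind k′
  ... | diagonal | diagonal = refl
  ... | diagonal | inner b  = ⊥-elim (D⇒≢ε b g (trans (sym (C-inner b g)) g∈k′) (==⇒≡ g∈k))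
  ... | diagonal | outer    = ⊥-elim (outer⇒≢ε g∈k′ (==⇒≡ g∈k))
  ... | inner a  | diagonal = ⊥-elim (D⇒≢ε a g (trans (sym (C-inner a g)) g∈k) (==⇒≡ g∈k′))
  ... | inner a  | outer    = ⊥-elim (inner-outer a g∈k g∈k′)
  ... | outer    | diagonal = ⊥-elim (outer⇒≢ε g∈k (==⇒≡ g∈k′))
  ... | outer    | inner b  = ⊥-elim (inner-outer b g∈k′ g∈k)
  ... | outer    | outer    = refl
  ... | inner a  | inner b  with a ≟ b
  ...   | yes refl = refl
  ...   | no a≢b   = contradiction (trans (sym (disjoint a b a≢b g (trans (sym (C-inner a g)) g∈k)))
                                          (trans (sym (C-inner b g)) g∈k′)) λ ()

  class-exists : ∀ g → ∃ λ k → C k g ≡ true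
  class-exists g with g ≟ ε
  ... | yes g≡ε = zero , ≡⇒== g≡ε
  ... | no g≢ε with inD g in g∈?D
  ...   | true  = let (a , g∈Da) = inD-elim g g∈?D in suc (inject₁ a) , trans (C-inner a g) g∈Da
  ...   | false = out , trans (C-outer g) (cong₂ (λ b c → not b ∧ not c) g∈?D (≢⇒==false g≢ε))

  partition : ∀ g → ∃ λ k → C k g ≡ true × (∀ k′ → C k′ g ≡ true → k′ ≡ k)
  partition g = let (k , g∈k) = class-exists g in k , g∈k , λ k′ g∈k′ → class-unique k′ k g∈k′ g∈k

  class-membership : ∀ {g} k → C k g ≡ true → ∀ j → C j g ≡ ⌊ j ≟ k ⌋
  class-membership k g∈k j = bool-ext (λ g∈j → ≡⇒== (class-unique j k g∈j g∈k))
                                      (λ j==k → trans (cong (λ i → C i _) (==⇒≡ j==k)) g∈k)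

  class-count : ∀ g → sum (λ k → ind (C k g)) ≡ 1
  class-count g = let (k , g∈k) = class-exists g in begin
    sum (λ k → ind (C k g))  ≡⟨ count≡sum (λ k → C k g) ⟨
    count (λ k → C k g)      ≡⟨ count-single (λ k → C k g) k (λ k′ g∈k′ → class-unique k′ k g∈k′ g∈k) ⟩
    ind (C k g)              ≡⟨ cong ind g∈k ⟩
    1                        ∎

  class-inverse : ∀ i → ∃ λ j → ∀ g → C i (g ⁻¹) ≡ C j g
  class-inverse i with kind i
  ... | diagonal = zero , inverse-==ε
  ... | inner a with IsWPDS.inverse W a
  ...   | b , Da⁻¹≡Db = suc (inject₁ b) , λ g →
          trans (C-inner a (g ⁻¹)) (trans (Da⁻¹≡Db g) (sym (C-inner b g)))
  class-inverse i | outer = out , λ g → begin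
    C out (g ⁻¹)                            ≡⟨ C-outer (g ⁻¹) ⟩
    not (inD (g ⁻¹)) ∧ not ((g ⁻¹) == ε)    ≡⟨ cong₂ (λ b c → not b ∧ not c) (inD-inverse g) (inverse-==ε g) ⟩
    outside g                               ≡⟨ C-outer g ⟨
    C out g                                 ∎

  -- N i j g = #{w ∈ C_i : g w⁻¹ ∈ C_j}, the number of ways to write
  -- g = a b with a ∈ C_i and b ∈ C_j
  N : Index → Index → Fin n → ℕ
  N i j g = count (λ w → C i w ∧ C j (g ∙ w ⁻¹))

  -- The number of paths x → z → y through R_i and R_j is N i j (x y⁻¹);
  -- substitute z = x w⁻¹.
  path-count : ∀ i j x y → count (λ z → schemeRel G D i x z ∧ schemeRel G D j z y) ≡ N i j (x ∙ y ⁻¹)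
  path-count i j x y = begin
    count (λ z → schemeRel G D i x z ∧ schemeRel G D j z y)
      ≡⟨ count-cong (λ z → cong₂ _∧_ (rel≡class i x z) (rel≡class j z y)) ⟩
    count (λ z → C i (x ∙ z ⁻¹) ∧ C j (z ∙ y ⁻¹))
      ≡⟨ count-involution _ (λ w → x ∙ w ⁻¹) (reflect-involutive x) ⟩
    count (λ w → C i (x ∙ (x ∙ w ⁻¹) ⁻¹) ∧ C j (x ∙ w ⁻¹ ∙ y ⁻¹))
      ≡⟨ count-cong (λ w → cong₂ (λ u v → C i u ∧ C j v) (reflect-involutive x w) (quotient-swap x w y)) ⟩
    N i j (x ∙ y ⁻¹) ∎

  -- N is symmetric because G is abelian: substitute w = g v⁻¹.
  N-sym : ∀ i j g → N i j g ≡ N j i g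
  N-sym i j g = begin
    N i j g
      ≡⟨ count-involution _ (λ v → g ∙ v ⁻¹) (reflect-involutive g) ⟩
    count (λ v → C i (g ∙ v ⁻¹) ∧ C j (g ∙ (g ∙ v ⁻¹) ⁻¹))
      ≡⟨ count-cong (λ v → cong (λ u → C i (g ∙ v ⁻¹) ∧ C j u) (reflect-involutive g v)) ⟩
    count (λ v → C i (g ∙ v ⁻¹) ∧ C j v)
      ≡⟨ count-cong (λ v → ∧-comm (C i (g ∙ v ⁻¹)) (C j v)) ⟩
    N j i g ∎

  -- Each w ∈ C_i contributes to exactly one N i j g, so ∑_j N i j g = |C_i|.
  N-rowSum : ∀ i g → sum (λ j → N i j g) ≡ count (C i)
  N-rowSum i g = begin
    sum (λ j → N i j g)                                    ≡⟨ sum-cong-≗ (λ j → count≡sum (λ w → C i w ∧ C j (g ∙ w ⁻¹))) ⟩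
    sum (λ j → sum (λ w → ind (C i w ∧ C j (g ∙ w ⁻¹))))  ≡⟨ ∑-comm (λ j w → ind (C i w ∧ C j (g ∙ w ⁻¹))) ⟩
    sum (λ w → sum (λ j → ind (C i w ∧ C j (g ∙ w ⁻¹))))  ≡⟨ sum-cong-≗ one-class ⟩
    sum (λ w → ind (C i w))                                ≡⟨ count≡sum (C i) ⟨
    count (C i)                                            ∎
    where
    one-class : ∀ w → sum (λ j → ind (C i w ∧ C j (g ∙ w ⁻¹))) ≡ ind (C i w)
    one-class w with C i w
    ... | true  = class-count (g ∙ w ⁻¹)
    ... | false = sum-zero (λ j → ind (false ∧ C j (g ∙ w ⁻¹))) (λ _ → refl)

  N-diagonal : ∀ j g → N zero j g ≡ ind (C j g)
  N-diagonal j g = begin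
    N zero j g                        ≡⟨ count-single _ ε (λ w w∈C₀ → ==⇒≡ (∧-elimˡ w∈C₀)) ⟩
    ind ((ε == ε) ∧ C j (g ∙ ε ⁻¹))   ≡⟨ cong₂ (λ b h → ind (b ∧ C j h)) (≡⇒== refl) (quotient-ε g) ⟩
    ind (C j g)                       ∎

  -- For inner classes, N is a multiplicity in a difference list D_a D_m⁻¹,
  -- where D_m = D_b⁻¹: the pairs (d₁ , d₂) with d₁ d₂⁻¹ = g are (w , w g⁻¹).
  N≡diffCount : ∀ a b m → (∀ h → D b (h ⁻¹) ≡ D m h) → ∀ g →
                N (suc (inject₁ a)) (suc (inject₁ b)) g ≡ diffCount G (D a) (D m) g
  N≡diffCount a b m Db⁻¹≡Dm g = begin
    N (suc (inject₁ a)) (suc (inject₁ b)) g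
      ≡⟨ count-cong (λ w → cong₂ _∧_ (C-inner a w) (C-inner b (g ∙ w ⁻¹))) ⟩
    count (λ w → D a w ∧ D b (g ∙ w ⁻¹))
      ≡⟨ count≡sum (λ w → D a w ∧ D b (g ∙ w ⁻¹)) ⟩
    sum (λ w → ind (D a w ∧ D b (g ∙ w ⁻¹)))
      ≡⟨ sum-cong-≗ partner ⟨
    sum (λ d₁ → count (λ d₂ → D a d₁ ∧ D m d₂ ∧ ((d₁ ∙ d₂ ⁻¹) == g)))
      ≡⟨ sumFin≡sum (λ d₁ → count (λ d₂ → D a d₁ ∧ D m d₂ ∧ ((d₁ ∙ d₂ ⁻¹) == g))) ⟨
    diffCount G (D a) (D m) g ∎
    where
    partner : ∀ d₁ → count (λ d₂ → D a d₁ ∧ D m d₂ ∧ ((d₁ ∙ d₂ ⁻¹) == g)) ≡ ind (D a d₁ ∧ D b (g ∙ d₁ ⁻¹))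
    partner d₁ = begin
      count (λ d₂ → D a d₁ ∧ D m d₂ ∧ ((d₁ ∙ d₂ ⁻¹) == g))
        ≡⟨ count-single _ (d₁ ∙ g ⁻¹) (λ d₂ e → quotient-solve d₁ d₂ g (==⇒≡ (∧-elimʳ (∧-elimʳ {D a d₁} e)))) ⟩
      ind (D a d₁ ∧ D m (d₁ ∙ g ⁻¹) ∧ ((d₁ ∙ (d₁ ∙ g ⁻¹) ⁻¹) == g))
        ≡⟨ cong (λ t → ind (D a d₁ ∧ D m (d₁ ∙ g ⁻¹) ∧ t)) (≡⇒== (reflect-involutive d₁ g)) ⟩
      ind (D a d₁ ∧ D m (d₁ ∙ g ⁻¹) ∧ true)
        ≡⟨ cong (λ t → ind (D a d₁ ∧ t)) (∧-identityʳ _) ⟩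
      ind (D a d₁ ∧ D m (d₁ ∙ g ⁻¹))
        ≡⟨ cong (λ t → ind (D a d₁ ∧ t)) (trans (sym (Db⁻¹≡Dm _)) (cong (D b) (quotient-inverse d₁ g))) ⟩
      ind (D a d₁ ∧ D b (g ∙ d₁ ⁻¹)) ∎

  Constant : Index → Index → Index → Set
  Constant i j k = ConstantOn (C k) (N i j)

  constant-sym : ∀ i j k → Constant i j k → Constant j i k
  constant-sym i j k (p , const) = p , λ g g∈k → trans (N-sym j i g) (const g g∈k)

  constant-diagonal : ∀ j k → Constant zero j k
  constant-diagonal j k = ind ⌊ j ≟ k ⌋ , λ g g∈k → trans (N-diagonal j g) (cong ind (class-membership k g∈k j))

  -- the WPDS axioms, with D_m = D_b⁻¹
  constant-inner : ∀ a b k → Constant (suc (inject₁ a)) (suc (inject₁ b)) k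
  constant-inner a b k with IsWPDS.inverse W b
  ... | m , Db⁻¹≡Dm with kind k
  ...   | diagonal = N (suc (inject₁ a)) (suc (inject₁ b)) ε ,
                       λ g g∈C₀ → cong (N (suc (inject₁ a)) (suc (inject₁ b))) (==⇒≡ g∈C₀)
  ...   | inner l with IsWPDS.lambda W a m l
  ...     | λₐₘₗ , lambda = λₐₘₗ , λ g g∈Dl →
            let g∈Dl′ = trans (sym (C-inner l g)) g∈Dl in
            trans (N≡diffCount a b m Db⁻¹≡Dm g) (lambda g g∈Dl′ (D⇒≢ε l g g∈Dl′))
  constant-inner a b k | m , Db⁻¹≡Dm | outer with IsWPDS.mu W a m
  ...     | μₐₘ , mu = μₐₘ , λ g g∈out →
            trans (N≡diffCount a b m Db⁻¹≡Dm g) (mu g (outer⇒∉D g∈out) (outer⇒≢ε g∈out))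

  constant-base : ∀ i j k → i ≢ out → j ≢ out → Constant i j k
  constant-base i j k i≢out j≢out with kind i | kind j
  ... | diagonal | _        = constant-diagonal j k
  ... | inner a  | diagonal = constant-sym zero i k (constant-diagonal i k)
  ... | inner a  | inner b  = constant-inner a b k
  ... | outer    | _        = contradiction refl i≢out
  ... | inner a  | outer    = contradiction refl j≢out

  -- the column of C_out, determined by the row sums
  constant-toOut : ∀ i k → (∀ j → j ≢ out → Constant i j k) → Constant i out k
  constant-toOut i k = constant-remaining (C k) (N i) out (count (C i) , λ g _ → N-rowSum i g)

  constant-inner-out : ∀ i k → i ≢ out → Constant i out k
  constant-inner-out i k i≢out = constant-toOut i k (λ j j≢out → constant-base i j k i≢out j≢out)

  constant : ∀ i j k → Constant i j k
  constant i j k with i ≟ out | j ≟ out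
  ... | no i≢out | no j≢out = constant-base i j k i≢out j≢out
  ... | no i≢out | yes refl = constant-inner-out i k i≢out
  ... | yes refl | no j≢out = constant-sym j out k (constant-inner-out j k j≢out)
  ... | yes refl | yes refl = constant-toOut out k (λ j j≢out → constant-sym j out k (constant-inner-out j k j≢out))

mainTheorem5 : (n : ℕ) (G : FiniteAbelianGroup n) (r : ℕ) (D : Fin r → Fin n → Bool) →
    (∀ i j → i ≢ j → ¬ (∀ g → D i g ≡ D j g)) →
    (∀ i j → i ≢ j → ∀ g → D i g ≡ true → D j g ≡ false) →
    (∀ i → D i (FiniteAbelianGroup.ε G) ≡ false) →
    IsWPDS G r D →
    ∃₂ (λ x y → relOut G D x y ≡ true) →
    IsAssociationScheme n (suc r) (schemeRel G D)
mainTheorem5 n G r D _ disjoint ε∉D W _ = record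
  { diagonal     = λ x y → mk⇔ ==⇒≡ ≡⇒==
  ; partition    = λ x y → let (k , xy⁻¹∈k , unique) = partition (x ∙ y ⁻¹) in
      k , R≡C k x y xy⁻¹∈k , λ k′ xy∈R → unique k′ (C≡R k′ x y xy∈R)
  ; transposes   = λ i → let (j , inverse) = class-inverse i in
      j , λ x y → begin
        schemeRel G D i y x     ≡⟨ rel≡class i y x ⟩
        C i (y ∙ x ⁻¹)          ≡⟨ cong (C i) (quotient-inverse x y) ⟨
        C i ((x ∙ y ⁻¹) ⁻¹)     ≡⟨ inverse (x ∙ y ⁻¹) ⟩
        C j (x ∙ y ⁻¹)          ≡⟨ rel≡class j x y ⟨
        schemeRel G D j x y     ∎
  ; intersection = λ i j k → let (p , const) = constant i j k in
      p , λ x y xy∈Rk → trans (path-count i j x y) (const (x ∙ y ⁻¹) (C≡R k x y xy∈Rk))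
  }
  where
  open FiniteAbelianGroup G
  open GroupFacts G using (quotient-inverse)
  open Scheme G D disjoint ε∉D W
  R≡C : ∀ k x y → C k (x ∙ y ⁻¹) ≡ true → schemeRel G D k x y ≡ true
  R≡C k x y = trans (rel≡class k x y)
  C≡R : ∀ k x y → schemeRel G D k x y ≡ true → C k (x ∙ y ⁻¹) ≡ true
  C≡R k x y = trans (sym (rel≡class k x y))
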